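{- Let $G$ be a finite simple connected graph with $n$ vertices and $m$ edges that has at least one perfect matching. Then \[\mathrm{cf}(G)\le \left(1-\frac{1}{\sqrt{2m-n+1}}\right)m.\]
   Context: A perfect matching of $G$ is a set of pairwise disjoint edges covering every vertex. For a perfect matching $M$, a subset $S\subseteq M$ is a forcing set of $M$ if $M$ is the unique perfect matching of $G$ containing $S$. A subset $S\subseteq E(G)$ is a complete forcing set of $G$ if for every perfect matching $M$ of $G$, $S\cap M$ is a forcing set of $M$; $\mathrm{cf}(G)$ is the minimum size of a complete forcing set of $G$. -}

module Defs where

open import Data.Nat using (ℕ; _<_; _≤_; _+_; _*_; _∸_; _^_)
open import Data.Fin using (Fin; toℕ)
open import Data.Fin.Subset using (Subset; _∈_; _⊆_; _∩_; ∣_∣)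
open import Data.Product using (Σ; ∃; _×_; _,_; proj₁; proj₂)
open import Data.Sum using (_⊎_)
open import Function.Definitions using (Injective)
open import Relation.Binary.PropositionalEquality using (_≡_)
open import Relation.Binary.Construct.Closure.ReflexiveTransitive using (Star)

-- Each edge e is an unordered pair {u, v} with u ≠ v, stored canonically
-- as (u , v) with u < v; distinct edges have distinct endpoint pairs
-- (no multi-edges).
record Graph (n m : ℕ) : Set where
  field
    ends      : Fin m → Fin n × Fin n
    ordered   : ∀ e → toℕ (proj₁ (ends e)) < toℕ (proj₂ (ends e))
    ends-inj  : Injective _≡_ _≡_ ends

module _ {n m : ℕ} (G : Graph n m) where
  open Graph G

  Incident : Fin n → Fin m → Set
  Incident v e = (proj₁ (ends e) ≡ v) ⊎ (proj₂ (ends e) ≡ v)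

  Adjacent : Fin n → Fin n → Set
  Adjacent u v = ∃ λ e → (ends e ≡ (u , v)) ⊎ (ends e ≡ (v , u))

  Connected : Set
  Connected = ∀ u v → Star Adjacent u v

  IsPerfectMatching : Subset m → Set
  IsPerfectMatching M =
    ∀ v → (∃ λ e → e ∈ M × Incident v e)
        × (∀ e e′ → e ∈ M → e′ ∈ M → Incident v e → Incident v e′ → e ≡ e′)

  IsForcingSet : Subset m → Subset m → Set
  IsForcingSet M S =
    S ⊆ M × (∀ M′ → IsPerfectMatching M′ → S ⊆ M′ → M′ ≡ M)

  IsCompleteForcingSet : Subset m → Set
  IsCompleteForcingSet S =
    ∀ M → IsPerfectMatching M → IsForcingSet M (S ∩ M)

-- Fix a maximal independent set I and send every vertex u ∉ I to its anchor, the least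
-- neighbour of u in I. The edges joining each u ∉ I to its anchor form a set A with
-- |A| ≥ n − |I|, and the complement of A is a complete forcing set: if perfect matchings M, M′
-- satisfy M ∖ M′ ⊆ A but M ≠ M′, take the least x ∈ I whose M-edge is not in M′ and let z be
-- its M′-partner. Then z ∉ I, so the M-edge of z lies in A and ends at the anchor of z, which
-- minimality of x forces to be x; hence the M- and M′-edges at z both join x and z, absurd.
-- A perfect matching injects I into its complement, so n ≤ 2|A|, and together with
-- 2m ≤ n(n − 1) this yields m² ≤ |A|²(2m + 1 − n).

module Submission where

open import Defs
open import Data.Nat using (ℕ; _≤_; _+_; _*_; _∸_; _^_)
open import Data.Fin.Subset using (Subset; ∣_∣)
open import Data.Product using (∃; _×_)

open import Data.Empty using (⊥)
open import Data.Fin using (Fin; zero; suc; toℕ)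
open import Data.Fin.Properties using (any?; _≟_; injective⇒≤; +↔⊎; *↔×)
import Data.Fin.Properties as Fin
open import Data.Fin.Subset using (_∈_; _∉_; _⊆_; ∁; _-_; inside; outside)
open import Data.Fin.Subset.Properties
  using ( _∈?_; ⊆-antisym; ∣p∣≤n; ∣∁p∣≡n∸∣p∣; x∈p∩q⁺; p∩q⊆q; x∉∁p⇒x∈p; x∈∁p⇒x∉p; x∉p⇒x∈∁p
        ; x∈p∧x≢y⇒x∈p-y; x∈p⇒∣p-x∣<∣p∣)
open import Data.Nat using (zero; suc; z≤n; s≤s; _<_)
open import Data.Nat.Properties
  using ( ≤-trans; ≤-antisym; <-irrefl; <-asym; +-mono-≤; +-monoʳ-≤; +-monoˡ-≤; *-mono-≤; *-monoʳ-≤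
        ; *-monoˡ-≤; *-cancelˡ-≤; *-identityʳ; m+[n∸m]≡n; m∸[m∸n]≡n; +-∸-assoc; module ≤-Reasoning)
open import Data.Nat.Tactic.RingSolver using (solve-∀)
open import Data.Product using (_,_; proj₁; proj₂; swap)
open import Data.Product.Properties using (≡-dec)
open import Data.Sum using (_⊎_; inj₁; inj₂)
import Data.Sum as Sum
open import Data.Sum.Function.Propositional using (_⊎-↔_)
open import Data.Vec using (_∷_; []; here; there; tabulate)
open import Data.Vec.Properties using (lookup∘tabulate; []=⇒lookup; lookup⇒[]=)
open import Function using (_∘_; Injective)
open import Function.Bundles using (Injection; _↣_; mk↣)
open import Function.Construct.Composition using (_↣-∘_; _↔-∘_)
open import Function.Construct.Identity using (↔-id)
open import Function.Construct.Symmetry using (↔-sym)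
open import Function.Properties.Inverse using (↔⇒↣)
open import Relation.Binary using (Rel; Symmetric; Irreflexive)
open import Relation.Binary.PropositionalEquality
open import Relation.Nullary using (¬_; Dec; yes; no; does; contradiction)
open import Relation.Nullary.Decidable using (_×-dec_; _⊎-dec_; ¬?; dec-true; decidable-stable)
open import Relation.Unary using (Pred; Decidable)

[n+a]²≤n²[1+a] : ∀ n a → n + (n + a) ≤ n * n → (n + a) * (n + a) ≤ n * n * suc a
[n+a]²≤n²[1+a] n a n+[n+a]≤n² = begin
  (n + a) * (n + a)          ≡⟨ expand n a ⟩
  n * n + a * (n + (n + a))  ≤⟨ +-monoʳ-≤ (n * n) (*-monoʳ-≤ a n+[n+a]≤n²) ⟩
  n * n + a * (n * n)        ≡⟨ collect n a ⟩
  n * n * suc a              ∎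
  where
  open ≤-Reasoning
  expand : ∀ n a → (n + a) * (n + a) ≡ n * n + a * (n + (n + a))
  expand = solve-∀
  collect : ∀ n a → n * n + a * (n * n) ≡ n * n * suc a
  collect = solve-∀

m²≤k²[2m+1∸n] : ∀ {n m k} → n ≤ k + k → k ≤ m → n + (m + m) ≤ n * n →
                m ^ 2 ≤ k ^ 2 * (2 * m + 1 ∸ n)
m²≤k²[2m+1∸n] {n} {m} {k} n≤2k k≤m n+2m≤n² = *-cancelˡ-≤ 4 (begin
  4 * m ^ 2                     ≡⟨ cong (4 *_) (square m) ⟩
  4 * (m * m)                   ≡⟨ four-squares m ⟩
  (m + m) * (m + m)             ≡⟨ cong (λ t → t * t) n+a≡2m ⟨
  (n + a) * (n + a)             ≤⟨ [n+a]²≤n²[1+a] n a n+[n+a]≤n² ⟩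
  n * n * suc a                 ≤⟨ *-monoˡ-≤ (suc a) (*-mono-≤ n≤2k n≤2k) ⟩
  (k + k) * (k + k) * suc a     ≡⟨ four-squares-times k (suc a) ⟩
  4 * (k * k * suc a)           ≡⟨ cong (λ t → 4 * (t * suc a)) (square k) ⟨
  4 * (k ^ 2 * suc a)           ≡⟨ cong (λ t → 4 * (k ^ 2 * t)) 2m+1∸n≡1+a ⟨
  4 * (k ^ 2 * (2 * m + 1 ∸ n)) ∎)
  where
  open ≤-Reasoning
  a : ℕ
  a = m + m ∸ n
  n≤2m : n ≤ m + m
  n≤2m = ≤-trans n≤2k (+-mono-≤ k≤m k≤m)
  n+a≡2m : n + a ≡ m + m
  n+a≡2m = m+[n∸m]≡n n≤2m
  n+[n+a]≤n² : n + (n + a) ≤ n * n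
  n+[n+a]≤n² = subst (λ t → n + t ≤ n * n) (sym n+a≡2m) n+2m≤n²
  square : ∀ x → x ^ 2 ≡ x * x
  square x = cong (x *_) (*-identityʳ x)
  four-squares : ∀ x → 4 * (x * x) ≡ (x + x) * (x + x)
  four-squares = solve-∀
  four-squares-times : ∀ x y → (x + x) * (x + x) * y ≡ 4 * (x * x * y)
  four-squares-times = solve-∀
  double+1 : ∀ x → 2 * x + 1 ≡ 1 + (x + x)
  double+1 = solve-∀
  2m+1∸n≡1+a : 2 * m + 1 ∸ n ≡ suc a
  2m+1∸n≡1+a = trans (cong (_∸ n) (double+1 m)) (+-∸-assoc 1 n≤2m)

least-witness : ∀ {n p} {P : Pred (Fin n) p} → Decidable P → ∃ P →
                ∃ λ x → P x × (∀ {y} → P y → toℕ x ≤ toℕ y)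
least-witness {suc n} P? (y , py) with P? zero
... | yes p₀ = zero , p₀ , λ _ → z≤n
least-witness {suc n} P? (zero , p₀)  | no ¬p₀ = contradiction p₀ ¬p₀
least-witness {suc n} P? (suc y , py) | no ¬p₀ with least-witness (P? ∘ suc) (y , py)
... | x , px , x-least =
  suc x , px , λ { {zero} p₀ → contradiction p₀ ¬p₀ ; {suc _} py → s≤s (x-least py) }

select : ∀ {n p} {P : Pred (Fin n) p} → Decidable P → Subset n
select P? = tabulate (does ∘ P?)

module _ {n p} {P : Pred (Fin n) p} (P? : Decidable P) where

  ∈-select⁺ : ∀ {x} → P x → x ∈ select P?
  ∈-select⁺ {x} px = lookup⇒[]= x _ (trans (lookup∘tabulate (does ∘ P?) x) (dec-true (P? x) px))

  ∈-select⁻ : ∀ {x} → x ∈ select P? → P x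
  ∈-select⁻ {x} x∈ with P? x | trans (sym (lookup∘tabulate (does ∘ P?) x)) ([]=⇒lookup x∈)
  ... | yes px | _ = px
  ... | no _   | ()

∉-≢-∈ : ∀ {n} {p : Subset n} {x y} → x ∉ p → y ∈ p → x ≢ y
∉-≢-∈ x∉p y∈p refl = x∉p y∈p

injection⇒∣p∣≤∣q∣ : ∀ {a b} {p : Subset a} {q : Subset b} (f : ∀ x → x ∈ p → Fin b) →
                    (∀ x x∈p → f x x∈p ∈ q) →
                    (∀ {x y} x∈p y∈p → f x x∈p ≡ f y y∈p → x ≡ y) →
                    ∣ p ∣ ≤ ∣ q ∣
injection⇒∣p∣≤∣q∣ {p = []} _ _ _ = z≤n
injection⇒∣p∣≤∣q∣ {p = outside ∷ p} f f∈q f-inj =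
  injection⇒∣p∣≤∣q∣ (λ x → f (suc x) ∘ there) (λ x → f∈q (suc x) ∘ there)
    (λ x∈p y∈p → Fin.suc-injective ∘ f-inj (there x∈p) (there y∈p))
injection⇒∣p∣≤∣q∣ {p = inside ∷ p} {q} f f∈q f-inj = ≤-trans
  (s≤s (injection⇒∣p∣≤∣q∣ {q = q - f zero here} (λ x → f (suc x) ∘ there)
    (λ x x∈p → x∈p∧x≢y⇒x∈p-y (f∈q (suc x) (there x∈p)) (Fin.0≢1+n ∘ sym ∘ f-inj (there x∈p) here))
    (λ x∈p y∈p → Fin.suc-injective ∘ f-inj (there x∈p) (there y∈p))))
  (x∈p⇒∣p-x∣<∣p∣ (f∈q zero here))

module _ {n ℓ} (R : Rel (Fin n) ℓ) where

  Independent : Subset n → Set ℓ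
  Independent I = ∀ {u v} → u ∈ I → v ∈ I → ¬ R u v

  Dominates : Subset n → Fin n → Fin n → Set ℓ
  Dominates I w v = w ∈ I × (w ≡ v ⊎ R v w)

  Dominating : Subset n → Set ℓ
  Dominating I = ∀ v → ∃ λ w → Dominates I w v

dominating-∷ : ∀ {n ℓ} {R : Rel (Fin (suc n)) ℓ} {s I} →
               Dominating (λ u v → R (suc u) (suc v)) I →
               (∃ λ w → Dominates R (s ∷ I) w zero) →
               Dominating R (s ∷ I)
dominating-∷ _     dominated-zero zero = dominated-zero
dominating-∷ I-dom _ (suc v) with I-dom v
... | w , w∈I , inj₁ refl = suc w , there w∈I , inj₁ refl
... | w , w∈I , inj₂ vRw  = suc w , there w∈I , inj₂ vRw

independent-dominating : ∀ {n ℓ} {R : Rel (Fin n) ℓ} → (∀ u v → Dec (R u v)) →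
                         Symmetric R → Irreflexive _≡_ R →
                         ∃ λ I → Independent R I × Dominating R I
independent-dominating {zero} _ _ _ = [] , (λ ()) , λ ()
independent-dominating {suc n} {R = R} R? R-sym R-irrefl
  with I , I-indep , I-dom ← independent-dominating {R = λ u v → R (suc u) (suc v)}
                               (λ u v → R? (suc u) (suc v)) R-sym (R-irrefl ∘ cong suc)
  with any? (λ w → w ∈? I ×-dec R? zero (suc w))
... | yes (w , w∈I , 0Rw) =
  outside ∷ I , (λ { (there u∈I) (there v∈I) → I-indep u∈I v∈I }) ,
  dominating-∷ I-dom (suc w , there w∈I , inj₂ 0Rw)
... | no ¬dominated =
  inside ∷ I ,
  (λ { here        here        → R-irrefl refl
     ; here        (there v∈I) → λ 0Rv → ¬dominated (_ , v∈I , 0Rv)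
     ; (there u∈I) here        → λ uR0 → ¬dominated (_ , u∈I , R-sym uR0)
     ; (there u∈I) (there v∈I) → I-indep u∈I v∈I }) ,
  dominating-∷ I-dom (zero , here , inj₁ refl)

module _ {n m} (G : Graph n m) where
  open Graph G

  Joins : Fin m → Fin n → Fin n → Set
  Joins e u v = ends e ≡ (u , v) ⊎ ends e ≡ (v , u)

  ordered-≡ : ∀ {e u v} → ends e ≡ (u , v) → toℕ u < toℕ v
  ordered-≡ {e} eq = subst (λ (u , v) → toℕ u < toℕ v) eq (ordered e)

  ends-distinct : ∀ e → proj₁ (ends e) ≢ proj₂ (ends e)
  ends-distinct e eq = <-irrefl (cong toℕ eq) (ordered e)

  joins-irrefl : ∀ {e v} → ¬ Joins e v v
  joins-irrefl (inj₁ eq) = <-irrefl refl (ordered-≡ eq)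
  joins-irrefl (inj₂ eq) = <-irrefl refl (ordered-≡ eq)

  joins-unique : ∀ {e e′ u v} → Joins e u v → Joins e′ u v → e ≡ e′
  joins-unique (inj₁ eq) (inj₁ eq′) = ends-inj (trans eq (sym eq′))
  joins-unique (inj₂ eq) (inj₂ eq′) = ends-inj (trans eq (sym eq′))
  joins-unique (inj₁ eq) (inj₂ eq′) = contradiction (ordered-≡ eq) (<-asym (ordered-≡ eq′))
  joins-unique (inj₂ eq) (inj₁ eq′) = contradiction (ordered-≡ eq′) (<-asym (ordered-≡ eq))

  joins⇒incident : ∀ {e u v} → Joins e u v → Incident G u e × Incident G v e
  joins⇒incident (inj₁ eq) = inj₁ (cong proj₁ eq) , inj₂ (cong proj₂ eq)
  joins⇒incident (inj₂ eq) = inj₂ (cong proj₂ eq) , inj₁ (cong proj₁ eq)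

  incident⇒joins : ∀ {e u v} → u ≢ v → Incident G u e → Incident G v e → Joins e u v
  incident⇒joins u≢v (inj₁ refl) (inj₂ refl) = inj₁ refl
  incident⇒joins u≢v (inj₂ refl) (inj₁ refl) = inj₂ refl
  incident⇒joins u≢v (inj₁ refl) (inj₁ refl) = contradiction refl u≢v
  incident⇒joins u≢v (inj₂ refl) (inj₂ refl) = contradiction refl u≢v

  incident-either : ∀ {e u v w} → u ≢ v → Incident G u e → Incident G v e → Incident G w e →
                    w ≡ u ⊎ w ≡ v
  incident-either u≢v (inj₁ refl) (inj₁ refl) _ = contradiction refl u≢v
  incident-either u≢v (inj₂ refl) (inj₂ refl) _ = contradiction refl u≢v
  incident-either _ (inj₁ refl) (inj₂ refl) (inj₁ refl) = inj₁ refl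
  incident-either _ (inj₁ refl) (inj₂ refl) (inj₂ refl) = inj₂ refl
  incident-either _ (inj₂ refl) (inj₁ refl) (inj₁ refl) = inj₂ refl
  incident-either _ (inj₂ refl) (inj₁ refl) (inj₂ refl) = inj₁ refl

  other-endpoint : ∀ {e v} → Incident G v e → ∃ λ w → Incident G w e × w ≢ v
  other-endpoint {e} (inj₁ refl) = proj₂ (ends e) , inj₂ refl , ends-distinct e ∘ sym
  other-endpoint {e} (inj₂ refl) = proj₁ (ends e) , inj₁ refl , ends-distinct e

  incident? : ∀ v e → Dec (Incident G v e)
  incident? v e = (proj₁ (ends e) ≟ v) ⊎-dec (proj₂ (ends e) ≟ v)

  adjacent? : ∀ u v → Dec (Adjacent G u v)
  adjacent? u v = any? λ e → ≡-dec _≟_ _≟_ (ends e) (u , v) ⊎-dec ≡-dec _≟_ _≟_ (ends e) (v , u)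

  adjacent-sym : Symmetric (Adjacent G)
  adjacent-sym (e , uv) = e , Sum.swap uv

  adjacent-irrefl : Irreflexive _≡_ (Adjacent G)
  adjacent-irrefl refl (_ , vv) = joins-irrefl vv

  vertex-or-oriented-edge↣pair : (Fin n ⊎ (Fin m ⊎ Fin m)) ↣ (Fin n × Fin n)
  vertex-or-oriented-edge↣pair = mk↣ injective
    where
    pair : Fin n ⊎ (Fin m ⊎ Fin m) → Fin n × Fin n
    pair (inj₁ v)        = v , v
    pair (inj₂ (inj₁ e)) = ends e
    pair (inj₂ (inj₂ e)) = swap (ends e)

    injective : Injective _≡_ _≡_ pair
    injective {inj₁ _}        {inj₁ _}         eq = cong (inj₁ ∘ proj₁) eq
    injective {inj₂ (inj₁ _)} {inj₂ (inj₁ _)}  eq = cong (inj₂ ∘ inj₁) (ends-inj eq)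
    injective {inj₂ (inj₂ _)} {inj₂ (inj₂ _)}  eq = cong (inj₂ ∘ inj₂) (ends-inj (cong swap eq))
    injective {inj₁ _}        {inj₂ (inj₁ _)}  eq = contradiction (inj₁ (sym eq)) joins-irrefl
    injective {inj₁ _}        {inj₂ (inj₂ _)}  eq = contradiction (inj₁ (cong swap (sym eq))) joins-irrefl
    injective {inj₂ (inj₁ _)} {inj₁ _}         eq = contradiction (inj₁ eq) joins-irrefl
    injective {inj₂ (inj₂ _)} {inj₁ _}         eq = contradiction (inj₁ (cong swap eq)) joins-irrefl
    injective {inj₂ (inj₁ e)} {inj₂ (inj₂ e′)} eq =
      contradiction (ordered e) (<-asym (ordered-≡ {e′} (cong swap (sym eq))))
    injective {inj₂ (inj₂ e)} {inj₂ (inj₁ e′)} eq =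
      contradiction (ordered e′) (<-asym (ordered-≡ {e} (cong swap eq)))

  edge-bound : n + (m + m) ≤ n * n
  edge-bound = injective⇒≤ (Injection.injective
    (↔⇒↣ (↔-sym *↔×) ↣-∘ (vertex-or-oriented-edge↣pair ↣-∘ ↔⇒↣ ((↔-id _ ⊎-↔ +↔⊎) ↔-∘ +↔⊎))))

  module PerfectMatching {M : Subset m} (M-perfect : IsPerfectMatching G M) where

    edge : Fin n → Fin m
    edge v = proj₁ (proj₁ (M-perfect v))

    edge∈M : ∀ v → edge v ∈ M
    edge∈M v = proj₁ (proj₂ (proj₁ (M-perfect v)))

    edge-incident : ∀ v → Incident G v (edge v)
    edge-incident v = proj₂ (proj₂ (proj₁ (M-perfect v)))

    incident-unique : ∀ {v e e′} → e ∈ M → e′ ∈ M → Incident G v e → Incident G v e′ → e ≡ e′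
    incident-unique {v} = proj₂ (M-perfect v) _ _

    edge-unique : ∀ {v e} → e ∈ M → Incident G v e → edge v ≡ e
    edge-unique {v} e∈M = incident-unique (edge∈M v) e∈M (edge-incident v)

    mate : Fin n → Fin n
    mate v = proj₁ (other-endpoint (edge-incident v))

    mate-incident : ∀ v → Incident G (mate v) (edge v)
    mate-incident v = proj₁ (proj₂ (other-endpoint (edge-incident v)))

    mate≢ : ∀ v → mate v ≢ v
    mate≢ v = proj₂ (proj₂ (other-endpoint (edge-incident v)))

    edge-mate : ∀ v → edge (mate v) ≡ edge v
    edge-mate v = edge-unique (edge∈M v) (mate-incident v)

    adjacent-mate : ∀ v → Adjacent G v (mate v)
    adjacent-mate v = edge v , incident⇒joins (mate≢ v ∘ sym) (edge-incident v) (mate-incident v)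

    mate-injective : Injective _≡_ _≡_ mate
    mate-injective {x} {y} mate-x≡mate-y
      with incident-either (mate≢ x ∘ sym) (edge-incident x) (mate-incident x) y∈edge-x
      where
      edge-y≡edge-x : edge y ≡ edge x
      edge-y≡edge-x = begin
        edge y        ≡⟨ edge-mate y ⟨
        edge (mate y) ≡⟨ cong edge mate-x≡mate-y ⟨
        edge (mate x) ≡⟨ edge-mate x ⟩
        edge x        ∎
        where open ≡-Reasoning
      y∈edge-x : Incident G y (edge x)
      y∈edge-x = subst (Incident G y) edge-y≡edge-x (edge-incident y)
    ... | inj₁ y≡x      = sym y≡x
    ... | inj₂ y≡mate-x = contradiction (sym (trans y≡mate-x mate-x≡mate-y)) (mate≢ y)

  perfect-matching-⊆⇒≡ : ∀ {M M′} → IsPerfectMatching G M → IsPerfectMatching G M′ →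
                         M ⊆ M′ → M ≡ M′
  perfect-matching-⊆⇒≡ {M} {M′} M-perfect M′-perfect M⊆M′ = ⊆-antisym M⊆M′ M′⊆M
    where
    open PerfectMatching M-perfect
    M′⊆M : M′ ⊆ M
    M′⊆M {e} e∈M′ = subst (_∈ M) edge≡e (edge∈M (proj₁ (ends e)))
      where
      edge≡e : edge (proj₁ (ends e)) ≡ e
      edge≡e = PerfectMatching.incident-unique M′-perfect
                 (M⊆M′ (edge∈M _)) e∈M′ (edge-incident _) (inj₁ refl)

module CompleteForcingSet {n m} (G : Graph n m) {I : Subset n}
         (I-independent : Independent (Adjacent G) I)
         (I-dominating : Dominating (Adjacent G) I) where

  anchor-spec : ∀ u → ∃ λ w → Dominates (Adjacent G) I w u ×
                                (∀ {w′} → Dominates (Adjacent G) I w′ u → toℕ w ≤ toℕ w′)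
  anchor-spec u =
    least-witness (λ w → (w ∈? I) ×-dec ((w ≟ u) ⊎-dec adjacent? G u w)) (I-dominating u)

  anchor : Fin n → Fin n
  anchor u = proj₁ (anchor-spec u)

  anchor∈I : ∀ u → anchor u ∈ I
  anchor∈I u = proj₁ (proj₁ (proj₂ (anchor-spec u)))

  anchor-least : ∀ {u w} → w ∈ I → Adjacent G u w → toℕ (anchor u) ≤ toℕ w
  anchor-least {u} w∈I u~w = proj₂ (proj₂ (anchor-spec u)) (w∈I , inj₂ u~w)

  adjacent-anchor : ∀ {u} → u ∉ I → Adjacent G u (anchor u)
  adjacent-anchor {u} u∉I with proj₂ (proj₁ (proj₂ (anchor-spec u)))
  ... | inj₁ anchor≡u = contradiction (sym anchor≡u) (∉-≢-∈ u∉I (anchor∈I u))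
  ... | inj₂ u~anchor = u~anchor

  anchorEdge : ∀ {u} → u ∉ I → Fin m
  anchorEdge u∉I = proj₁ (adjacent-anchor u∉I)

  anchorEdge-incident : ∀ {u} (u∉I : u ∉ I) →
                        Incident G u (anchorEdge u∉I) × Incident G (anchor u) (anchorEdge u∉I)
  anchorEdge-incident u∉I = joins⇒incident G (proj₂ (adjacent-anchor u∉I))

  IsAnchorEdge : Fin m → Set
  IsAnchorEdge e = ∃ λ u → u ∉ I × Incident G u e × Incident G (anchor u) e

  isAnchorEdge? : ∀ e → Dec (IsAnchorEdge e)
  isAnchorEdge? e = any? λ u → ¬? (u ∈? I) ×-dec (incident? G u e ×-dec incident? G (anchor u) e)

  anchorEdges : Subset m
  anchorEdges = select isAnchorEdge?

  forcingSet : Subset m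
  forcingSet = ∁ anchorEdges

  anchor-incident : ∀ {e u} → IsAnchorEdge e → u ∉ I → Incident G u e → Incident G (anchor u) e
  anchor-incident (u′ , u′∉I , u′∈e , anchor∈e) u∉I u∈e
    with incident-either G (∉-≢-∈ u′∉I (anchor∈I u′)) u′∈e anchor∈e u∈e
  ... | inj₁ refl        = anchor∈e
  ... | inj₂ u≡anchor-u′ = contradiction u≡anchor-u′ (∉-≢-∈ u∉I (anchor∈I u′))

  anchorEdge-injective : ∀ {u u′} (u∉I : u ∉ I) (u′∉I : u′ ∉ I) →
                         anchorEdge u∉I ≡ anchorEdge u′∉I → u ≡ u′
  anchorEdge-injective {u} {u′} u∉I u′∉I same-edge
    with u∈e , anchor∈e ← anchorEdge-incident u∉I
    with incident-either G (∉-≢-∈ u∉I (anchor∈I u)) u∈e anchor∈e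
           (subst (Incident G u′) (sym same-edge) (proj₁ (anchorEdge-incident u′∉I)))
  ... | inj₁ u′≡u      = sym u′≡u
  ... | inj₂ u′≡anchor = contradiction u′≡anchor (∉-≢-∈ u′∉I (anchor∈I u))

  module _ {M M′} (M-perfect : IsPerfectMatching G M) (M′-perfect : IsPerfectMatching G M′)
           (M∖M′⊆anchorEdges : ∀ {e} → e ∈ M → e ∉ M′ → e ∈ anchorEdges) where
    open PerfectMatching G M-perfect
    open PerfectMatching G M′-perfect using () renaming
      ( edge to edge′; edge∈M to edge′∈M′; edge-incident to edge′-incident
      ; edge-unique to edge′-unique; edge-mate to edge′-mate
      ; mate to mate′; mate-incident to mate′-incident; mate≢ to mate′≢
      ; adjacent-mate to adjacent-mate′)

    Bad : Fin n → Set
    Bad x = x ∈ I × edge x ∉ M′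

    no-least-bad : ∀ {x} → Bad x → (∀ {y} → Bad y → toℕ x ≤ toℕ y) → ⊥
    no-least-bad {x} (x∈I , edge-x∉M′) x-least = g∉M′ (subst (_∈ M′) f≡g (edge′∈M′ x))
      where
      f : Fin m
      f = edge′ x
      z : Fin n
      z = mate′ x
      g : Fin m
      g = edge z
      x≢z : x ≢ z
      x≢z = mate′≢ x ∘ sym
      z∉I : z ∉ I
      z∉I z∈I = I-independent x∈I z∈I (adjacent-mate′ x)
      f∉M : f ∉ M
      f∉M f∈M = edge-x∉M′ (subst (_∈ M′) (sym (edge-unique f∈M (edge′-incident x))) (edge′∈M′ x))
      g∉M′ : g ∉ M′
      g∉M′ g∈M′ = f∉M (subst (_∈ M) g≡f (edge∈M z))
        where
        g≡f : g ≡ f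
        g≡f = trans (sym (edge′-unique g∈M′ (edge-incident z))) (edge′-mate x)
      anchor-z∈g : Incident G (anchor z) g
      anchor-z∈g = anchor-incident g-anchor z∉I (edge-incident z)
        where
        g-anchor : IsAnchorEdge g
        g-anchor = ∈-select⁻ isAnchorEdge? (M∖M′⊆anchorEdges (edge∈M z) g∉M′)
      anchor-z-bad : Bad (anchor z)
      anchor-z-bad = anchor∈I z , subst (_∉ M′) (sym (edge-unique (edge∈M z) anchor-z∈g)) g∉M′
      anchor-z≡x : anchor z ≡ x
      anchor-z≡x = Fin.toℕ-injective (≤-antisym
        (anchor-least x∈I (adjacent-sym G (adjacent-mate′ x))) (x-least anchor-z-bad))
      f≡g : f ≡ g
      f≡g = joins-unique G
        (incident⇒joins G x≢z (edge′-incident x) (mate′-incident x))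
        (incident⇒joins G x≢z (subst (λ v → Incident G v g) anchor-z≡x anchor-z∈g) (edge-incident z))

    edge∈M′ : ∀ {x} → x ∈ I → edge x ∈ M′
    edge∈M′ {x} x∈I = decidable-stable (edge x ∈? M′) λ edge-x∉M′ →
      let _ , y-bad , y-least = least-witness (λ y → (y ∈? I) ×-dec ¬? (edge y ∈? M′))
                                              (x , x∈I , edge-x∉M′)
      in no-least-bad y-bad y-least

    M⊆M′ : M ⊆ M′
    M⊆M′ {e} e∈M = decidable-stable (e ∈? M′) λ e∉M′ →
      let u , _ , _ , anchor-u∈e = ∈-select⁻ isAnchorEdge? (M∖M′⊆anchorEdges e∈M e∉M′)
      in e∉M′ (subst (_∈ M′) (edge-unique e∈M anchor-u∈e) (edge∈M′ (anchor∈I u)))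

  forcingSet-complete : IsCompleteForcingSet G forcingSet
  forcingSet-complete M M-perfect = p∩q⊆q forcingSet M , λ M′ M′-perfect S∩M⊆M′ →
    sym (perfect-matching-⊆⇒≡ G M-perfect M′-perfect (M⊆M′ M-perfect M′-perfect λ e∈M e∉M′ →
      x∉∁p⇒x∈p λ e∈S → e∉M′ (S∩M⊆M′ (x∈p∩q⁺ (e∈S , e∈M)))))

  ∣∁I∣≤∣anchorEdges∣ : ∣ ∁ I ∣ ≤ ∣ anchorEdges ∣
  ∣∁I∣≤∣anchorEdges∣ = injection⇒∣p∣≤∣q∣ (λ _ → anchorEdge ∘ x∈∁p⇒x∉p)
    (λ u u∈∁I → ∈-select⁺ isAnchorEdge? (u , x∈∁p⇒x∉p u∈∁I , anchorEdge-incident (x∈∁p⇒x∉p u∈∁I)))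
    (λ u∈∁I u′∈∁I → anchorEdge-injective (x∈∁p⇒x∉p u∈∁I) (x∈∁p⇒x∉p u′∈∁I))

  ∣I∣≤∣∁I∣ : ∀ {M} → IsPerfectMatching G M → ∣ I ∣ ≤ ∣ ∁ I ∣
  ∣I∣≤∣∁I∣ M-perfect = injection⇒∣p∣≤∣q∣ (λ v _ → mate v)
    (λ v v∈I → x∉p⇒x∈∁p λ mate∈I → I-independent v∈I mate∈I (adjacent-mate v))
    (λ _ _ → mate-injective)
    where open PerfectMatching G M-perfect

  n≤2∣anchorEdges∣ : ∀ {M} → IsPerfectMatching G M → n ≤ ∣ anchorEdges ∣ + ∣ anchorEdges ∣
  n≤2∣anchorEdges∣ M-perfect = begin
    n                                ≡⟨ m+[n∸m]≡n (∣p∣≤n I) ⟨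
    ∣ I ∣ + (n ∸ ∣ I ∣)              ≡⟨ cong (∣ I ∣ +_) (∣∁p∣≡n∸∣p∣ I) ⟨
    ∣ I ∣ + ∣ ∁ I ∣                  ≤⟨ +-monoˡ-≤ ∣ ∁ I ∣ (∣I∣≤∣∁I∣ M-perfect) ⟩
    ∣ ∁ I ∣ + ∣ ∁ I ∣                ≤⟨ +-mono-≤ ∣∁I∣≤∣anchorEdges∣ ∣∁I∣≤∣anchorEdges∣ ⟩
    ∣ anchorEdges ∣ + ∣ anchorEdges ∣ ∎
    where open ≤-Reasoning

  m∸∣forcingSet∣≡∣anchorEdges∣ : m ∸ ∣ forcingSet ∣ ≡ ∣ anchorEdges ∣
  m∸∣forcingSet∣≡∣anchorEdges∣ =
    trans (cong (m ∸_) (∣∁p∣≡n∸∣p∣ anchorEdges)) (m∸[m∸n]≡n (∣p∣≤n anchorEdges))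

corollary1 : ∀ {n m : ℕ} (G : Graph n m)
    → Connected G
    → ∃ (IsPerfectMatching G)
    → ∃ λ (S : Subset m)
        → IsCompleteForcingSet G S
          × ∣ S ∣ ≤ m
          × m ^ 2 ≤ (m ∸ ∣ S ∣) ^ 2 * ((2 * m + 1) ∸ n)
corollary1 {n} {m} G _ (M , M-perfect) =
  forcingSet , forcingSet-complete , ∣p∣≤n forcingSet ,
  subst (λ k → m ^ 2 ≤ k ^ 2 * (2 * m + 1 ∸ n)) (sym m∸∣forcingSet∣≡∣anchorEdges∣)
    (m²≤k²[2m+1∸n] (n≤2∣anchorEdges∣ M-perfect) (∣p∣≤n anchorEdges) (edge-bound G))
  where
  maximal-independent : ∃ λ I → Independent (Adjacent G) I × Dominating (Adjacent G) I
  maximal-independent = independent-dominating (adjacent? G) (adjacent-sym G) (adjacent-irrefl G)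
  open CompleteForcingSet G (proj₁ (proj₂ maximal-independent)) (proj₂ (proj₂ maximal-independent))
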